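{- Let $G=(V,E,C)$ be a $C$-colored graph with no edge $\{u,v\}$ with $c(u)=c(v)$, let $k$ be a positive integer, let $D'$ be the rooted spanning tree of (the connected graph) $G$ produced by a depth-first search, and let $V_A$ be the set of vertices of $D'$ that are the parent of at least one leaf of $D'$. If $|V_A|\ge k$, then MEC on $G$ has a solution whose transitive closure has at least $k$ edges.
   Context: A $C$-colored graph assigns to each vertex $v$ a color $c(v)\in C$. A connected component is colorful if no two of its vertices share a color. If a graph has connected components with $n_1,\dots,n_t$ vertices, the number of edges in its transitive closure is $\sum_i n_i(n_i-1)/2$. MEC: given $G=(V,E,C)$, a solution is a set $E'\subseteq E$ such that every connected component of $(V,E\setminus E',C)$ is colorful; its value is the number of edges in the transitive closure of $(V,E\setminus E')$. The paper assumes throughout that no edge joins two vertices of the same color. -}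

module Defs where

open import Data.Nat using (ℕ; zero; suc; _+_; _<?_)
open import Data.Bool using (Bool; true; false; _∧_; _∨_; not; T; if_then_else_)
open import Data.Fin using (Fin; toℕ; _≟_)
open import Data.Product using (Σ; ∃; _×_; _,_)
open import Data.Sum using (_⊎_)
open import Relation.Binary.PropositionalEquality using (_≡_; _≢_)
open import Relation.Nullary.Decidable using (⌊_⌋)
open import Level using (Level)

-- Vertices are Fin n.  An (undirected) edge set is a symmetric Bool relation.
Rel : ℕ → Set
Rel n = Fin n → Fin n → Bool

anyᶠ : ∀ {n} → (Fin n → Bool) → Bool
anyᶠ {zero}  p = false
anyᶠ {suc n} p = p Data.Fin.zero ∨ anyᶠ (λ i → p (Data.Fin.suc i))

countᶠ : ∀ {n} → (Fin n → Bool) → ℕ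
countᶠ {zero}  p = 0
countᶠ {suc n} p = (if p Data.Fin.zero then 1 else 0) + countᶠ (λ i → p (Data.Fin.suc i))

sumᶠ : ∀ {n} → (Fin n → ℕ) → ℕ
sumᶠ {zero}  f = 0
sumᶠ {suc n} f = f Data.Fin.zero + sumᶠ (λ i → f (Data.Fin.suc i))

reach : ∀ {n} → ℕ → Rel n → Fin n → Fin n → Bool
reach zero    A u v = ⌊ u ≟ v ⌋
reach (suc s) A u v = reach s A u v ∨ anyᶠ (λ w → reach s A u w ∧ A w v)

-- u and v lie in the same connected component (paths of length < n suffice)
Connected : ∀ {n} → Rel n → Fin n → Fin n → Set
Connected {n} A u v = T (reach n A u v)

remove : ∀ {n} → Rel n → Rel n → Rel n
remove E E' u v = E u v ∧ not (E' u v)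

AllColorful : ∀ {n} {C : Set} → (Fin n → C) → Rel n → Set
AllColorful c A = ∀ u v → u ≢ v → Connected A u v → c u ≢ c v

-- number of edges of the transitive closure: unordered pairs {u,v}, u ≠ v, in the same component
closureEdges : ∀ {n} → Rel n → ℕ
closureEdges {n} A = sumᶠ (λ u → countᶠ (λ v → ⌊ toℕ u <? toℕ v ⌋ ∧ reach n A u v))

IsMECSolution : ∀ {n} {C : Set} → Rel n → (Fin n → C) → Rel n → Set
IsMECSolution E c E' =
  (∀ u v → T (E' u v) → T (E u v)) ×
  (∀ u v → E' u v ≡ E' v u) ×
  AllColorful c (remove E E')

iter : ∀ {A : Set} → (A → A) → ℕ → A → A
iter f zero    x = x
iter f (suc i) x = f (iter f i x)

-- rooted spanning tree given by parent pointers; every vertex reaches the root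
-- (so the pointer structure is a tree) and every tree edge {v, parent v} is in E.
-- It is a depth-first-search tree: every edge of G joins an ancestor/descendant pair.
record DFSTree {n : ℕ} (E : Rel n) : Set where
  field
    root       : Fin n
    parent     : Fin n → Fin n
    parent-root : parent root ≡ root
    reaches-root : ∀ v → ∃ λ i → iter parent i v ≡ root
    tree-edges : ∀ v → v ≢ root → T (E v (parent v))
    dfs-property : ∀ u v → T (E u v) →
      (∃ λ i → iter parent i v ≡ u) ⊎ (∃ λ i → iter parent i u ≡ v)

  isChild : Fin n → Fin n → Bool
  isChild v u = not ⌊ v ≟ root ⌋ ∧ ⌊ parent v ≟ u ⌋

  isLeaf : Fin n → Bool
  isLeaf v = not (anyᶠ (λ w → isChild w v))

  inVA : Fin n → Bool
  inVA u = anyᶠ (λ v → isChild v u ∧ isLeaf v)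

  sizeVA : ℕ
  sizeVA = countᶠ inVA

{-# OPTIONS --safe #-}
-- For every vertex u of V_A choose one leaf child ℓ(u). The tree edges
-- {u, ℓ(u)} are pairwise disjoint: a leaf has a single parent and no
-- children, so it is neither chosen twice nor itself in V_A. Deleting all
-- other edges leaves components that are single edges or isolated vertices;
-- these are colorful because adjacent vertices have different colors, and
-- each kept edge is one edge of the transitive closure, so the value is
-- |V_A| ≥ k.
module Submission where

open import Defs
open import Data.Nat using (ℕ; zero; suc; _+_; _<_; _≤_; z≤n; s≤s; _<?_)
open import Data.Nat.Properties
  using (≤-refl; ≤-trans; +-mono-≤; +-0-commutativeMonoid; module ≤-Reasoning)
open import Algebra.Properties.CommutativeMonoid.Sum +-0-commutativeMonoid
  using (sum-syntax; sum-cong-≗; ∑-distrib-+; ∑-comm)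
open import Data.Bool using (Bool; true; false; T; _∧_; _∨_; not; if_then_else_)
open import Data.Bool.Properties using (T-∧; T-∨; T-not-≡; ∨-comm)
open import Data.Fin using (Fin; toℕ; _≟_)
open import Data.Fin.Properties using (any?; <-cmp)
open import Data.Product using (∃; _×_; _,_; proj₁; proj₂)
open import Data.Sum using (_⊎_; inj₁; inj₂)
open import Data.Empty using (⊥; ⊥-elim)
open import Data.Unit using (tt)
open import Function using (_∘_)
open import Function.Bundles using (Equivalence)
open import Relation.Nullary using (yes; no)
open import Relation.Nullary.Decidable using (⌊_⌋; T?; toWitness; fromWitness; toWitnessFalse)
open import Relation.Binary.Definitions using (tri<; tri≈; tri>)
open import Relation.Binary.PropositionalEquality using (_≡_; _≢_; refl; sym; trans; cong; cong₂; subst)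

open Equivalence using (to; from)

private variable n : ℕ

_⊆ᴿ_ : Rel n → Rel n → Set
A ⊆ᴿ B = ∀ u v → T (A u v) → T (B u v)

Symmetric : Rel n → Set
Symmetric A = ∀ u v → A u v ≡ A v u

Functional : Rel n → Set
Functional A = ∀ {u v w} → T (A u v) → T (A u w) → v ≡ w

Injective : Rel n → Set
Injective A = ∀ {u v w} → T (A u w) → T (A v w) → u ≡ v

TargetsAreSinks : Rel n → Set
TargetsAreSinks A = ∀ {u v w} → T (A u v) → T (A v w) → ⊥

symmetrize : Rel n → Rel n
symmetrize A u v = A u v ∨ A v u

symmetrize-symmetric : (A : Rel n) → Symmetric (symmetrize A)
symmetrize-symmetric A u v = ∨-comm (A u v) (A v u)

symmetrize-functional : {A : Rel n} →
  Functional A → Injective A → TargetsAreSinks A → Functional (symmetrize A)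
symmetrize-functional fun inj sinks xy xz with to T-∨ xy | to T-∨ xz
... | inj₁ Axy | inj₁ Axz = fun Axy Axz
... | inj₁ Axy | inj₂ Azx = ⊥-elim (sinks Azx Axy)
... | inj₂ Ayx | inj₁ Axz = ⊥-elim (sinks Ayx Axz)
... | inj₂ Ayx | inj₂ Azx = inj Ayx Azx

anyᶠ⁺ : ∀ {n} {p : Fin n → Bool} i → T (p i) → T (anyᶠ p)
anyᶠ⁺ Fin.zero    t = from T-∨ (inj₁ t)
anyᶠ⁺ (Fin.suc i) t = from T-∨ (inj₂ (anyᶠ⁺ i t))

anyᶠ⁻ : ∀ {n} {p : Fin n → Bool} → T (anyᶠ p) → ∃ λ i → T (p i)
anyᶠ⁻ {suc n} t with to T-∨ t
... | inj₁ t₀ = Fin.zero , t₀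
... | inj₂ t₁ with anyᶠ⁻ t₁
...   | i , tᵢ = Fin.suc i , tᵢ

choice : Rel n → Rel n
choice A u v with any? (λ w → T? (A u w))
... | yes (w , _) = ⌊ w ≟ v ⌋
... | no _        = false

choice-⊆ : (A : Rel n) → choice A ⊆ᴿ A
choice-⊆ A u v t with any? (λ w → T? (A u w))
... | yes (w , Auw) = subst (T ∘ A u) (toWitness t) Auw

choice-functional : (A : Rel n) → Functional (choice A)
choice-functional A {u} t t′ with any? (λ w → T? (A u w))
... | yes (w , _) = trans (sym (toWitness t)) (toWitness t′)

choice-total : (A : Rel n) {u v : Fin n} → T (A u v) → ∃ λ w → T (choice A u w)
choice-total A {u} {v} Auv with any? (λ w → T? (A u w))
... | yes (w , _) = w , fromWitness refl
... | no  ¬∃      = ⊥-elim (¬∃ (v , Auv))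

reach-edge : ∀ s {A : Rel n} {u v} → T (A u v) → T (reach (suc s) A u v)
reach-edge zero    {u = u} Auv = from T-∨ (inj₂ (anyᶠ⁺ u (from T-∧ (fromWitness refl , Auv))))
reach-edge (suc s) Auv         = from T-∨ (inj₁ (reach-edge s Auv))

edge⇒Connected : ∀ {n} {A : Rel n} {u v} → T (A u v) → Connected A u v
edge⇒Connected {suc n} = reach-edge n

reach-⊆-matching : {A M : Rel n} → A ⊆ᴿ M → Symmetric M → Functional M →
  ∀ s {u v} → T (reach s A u v) → u ≡ v ⊎ T (M u v)
reach-⊆-matching A⊆M M-sym M-fun zero r = inj₁ (toWitness r)
reach-⊆-matching {M = M} A⊆M M-sym M-fun (suc s) {u} {v} r with to T-∨ r
... | inj₁ r′   = reach-⊆-matching A⊆M M-sym M-fun s r′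
... | inj₂ step with anyᶠ⁻ step
...   | w , uw∧wv with to T-∧ uw∧wv
...     | uw , Awv = extend (reach-⊆-matching A⊆M M-sym M-fun s uw) (A⊆M w v Awv)
  where
  extend : ∀ {w} → u ≡ w ⊎ T (M u w) → T (M w v) → u ≡ v ⊎ T (M u v)
  extend (inj₁ refl) Mwv = inj₂ Mwv
  extend {w} (inj₂ Muw) Mwv = inj₁ (M-fun (subst T (M-sym u w) Muw) Mwv)

indicator : Bool → ℕ
indicator b = if b then 1 else 0

indicator-mono : ∀ {a b} → (T a → T b) → indicator a ≤ indicator b
indicator-mono {false}         _ = z≤n
indicator-mono {true}  {true}  _ = ≤-refl
indicator-mono {true}  {false} h = ⊥-elim (h tt)

indicator-split : ∀ a l l′ → (T a → T l ⊎ T l′) → indicator a ≤ indicator (l ∧ a) + indicator (l′ ∧ a)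
indicator-split false _     _     _ = z≤n
indicator-split true  true  _     _ = s≤s z≤n
indicator-split true  false true  _ = s≤s z≤n
indicator-split true  false false h with h tt
... | inj₁ ()
... | inj₂ ()

indicator-∨-disjoint : ∀ l a b → (T a → T b → ⊥) →
  indicator (l ∧ a) + indicator (l ∧ b) ≡ indicator (l ∧ (a ∨ b))
indicator-∨-disjoint false _     _     _ = refl
indicator-∨-disjoint true  false _     _ = refl
indicator-∨-disjoint true  true  false _ = refl
indicator-∨-disjoint true  true  true  h = ⊥-elim (h tt tt)

countᶠ≡∑ : ∀ {n} (p : Fin n → Bool) → countᶠ p ≡ ∑[ i < n ] indicator (p i)
countᶠ≡∑ {zero}  p = refl
countᶠ≡∑ {suc n} p = cong (indicator (p Fin.zero) +_) (countᶠ≡∑ (p ∘ Fin.suc))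

sumᶠ≡∑ : ∀ {n} (f : Fin n → ℕ) → sumᶠ f ≡ ∑[ i < n ] f i
sumᶠ≡∑ {zero}  f = refl
sumᶠ≡∑ {suc n} f = cong (f Fin.zero +_) (sumᶠ≡∑ (f ∘ Fin.suc))

indicator-anyᶠ≤∑ : ∀ {n} (p : Fin n → Bool) → indicator (anyᶠ p) ≤ ∑[ i < n ] indicator (p i)
indicator-anyᶠ≤∑ {zero}  p = z≤n
indicator-anyᶠ≤∑ {suc n} p with p Fin.zero
... | true  = s≤s z≤n
... | false = indicator-anyᶠ≤∑ (p ∘ Fin.suc)

∑-mono-≤ : ∀ {n} {f g : Fin n → ℕ} → (∀ i → f i ≤ g i) → ∑[ i < n ] f i ≤ ∑[ i < n ] g i
∑-mono-≤ {zero}  f≤g = z≤n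
∑-mono-≤ {suc n} f≤g = +-mono-≤ (f≤g Fin.zero) (∑-mono-≤ (f≤g ∘ Fin.suc))

∑∑-mono-≤ : {f g : Fin n → Fin n → ℕ} → (∀ u v → f u v ≤ g u v) →
  ∑[ u < n ] ∑[ v < n ] f u v ≤ ∑[ u < n ] ∑[ v < n ] g u v
∑∑-mono-≤ f≤g = ∑-mono-≤ (λ u → ∑-mono-≤ (f≤g u))

∑∑-distrib-+ : (f g : Fin n → Fin n → ℕ) →
  ∑[ u < n ] ∑[ v < n ] (f u v + g u v) ≡ ∑[ u < n ] ∑[ v < n ] f u v + ∑[ u < n ] ∑[ v < n ] g u v
∑∑-distrib-+ {n} f g = trans (sum-cong-≗ (λ u → ∑-distrib-+ (f u) (g u)))
  (∑-distrib-+ (λ u → ∑[ v < n ] f u v) (λ u → ∑[ v < n ] g u v))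

_<ᵇ_ : Fin n → Fin n → Bool
u <ᵇ v = ⌊ toℕ u <? toℕ v ⌋

<ᵇ-connex : {u v : Fin n} → u ≢ v → T (u <ᵇ v) ⊎ T (v <ᵇ u)
<ᵇ-connex {u = u} {v} u≢v with <-cmp u v
... | tri< u<v _ _ = inj₁ (fromWitness u<v)
... | tri≈ _ u≡v _ = ⊥-elim (u≢v u≡v)
... | tri> _ _ v<u = inj₂ (fromWitness v<u)

closureEdges≡∑∑ : (A : Rel n) →
  closureEdges A ≡ ∑[ u < n ] ∑[ v < n ] indicator (u <ᵇ v ∧ reach n A u v)
closureEdges≡∑∑ {n} A =
  trans (sumᶠ≡∑ (λ u → countᶠ (λ v → u <ᵇ v ∧ reach n A u v)))
        (sum-cong-≗ (λ u → countᶠ≡∑ (λ v → u <ᵇ v ∧ reach n A u v)))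

-- Each arc of an asymmetric relation is counted once, at its smaller endpoint.
∑∑-asymmetric≤ : (R : Rel n) → (∀ {u v} → T (R u v) → T (R v u) → ⊥) →
  ∑[ u < n ] ∑[ v < n ] indicator (R u v) ≤ ∑[ u < n ] ∑[ v < n ] indicator (u <ᵇ v ∧ symmetrize R u v)
∑∑-asymmetric≤ {n} R asym = begin
  ∑[ u < n ] ∑[ v < n ] indicator (R u v)
    ≤⟨ ∑∑-mono-≤ (λ u v → indicator-split (R u v) (u <ᵇ v) (v <ᵇ u) (<ᵇ-connex ∘ irreflexive)) ⟩
  ∑[ u < n ] ∑[ v < n ] (indicator (u <ᵇ v ∧ R u v) + indicator (v <ᵇ u ∧ R u v))
    ≡⟨ ∑∑-distrib-+ (λ u v → indicator (u <ᵇ v ∧ R u v)) (λ u v → indicator (v <ᵇ u ∧ R u v)) ⟩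
  ∑[ u < n ] ∑[ v < n ] indicator (u <ᵇ v ∧ R u v) + ∑[ u < n ] ∑[ v < n ] indicator (v <ᵇ u ∧ R u v)
    ≡⟨ cong (∑[ u < n ] ∑[ v < n ] indicator (u <ᵇ v ∧ R u v) +_) (∑-comm (λ u v → indicator (v <ᵇ u ∧ R u v))) ⟩
  ∑[ u < n ] ∑[ v < n ] indicator (u <ᵇ v ∧ R u v) + ∑[ u < n ] ∑[ v < n ] indicator (u <ᵇ v ∧ R v u)
    ≡⟨ ∑∑-distrib-+ (λ u v → indicator (u <ᵇ v ∧ R u v)) (λ u v → indicator (u <ᵇ v ∧ R v u)) ⟨
  ∑[ u < n ] ∑[ v < n ] (indicator (u <ᵇ v ∧ R u v) + indicator (u <ᵇ v ∧ R v u))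
    ≡⟨ sum-cong-≗ (λ u → sum-cong-≗ (λ v → indicator-∨-disjoint (u <ᵇ v) (R u v) (R v u) asym)) ⟩
  ∑[ u < n ] ∑[ v < n ] indicator (u <ᵇ v ∧ symmetrize R u v) ∎
  where
  open ≤-Reasoning
  irreflexive : ∀ {u v} → T (R u v) → u ≢ v
  irreflexive Ruu refl = asym Ruu Ruu

remove-remove : {E M : Rel n} → M ⊆ᴿ E → ∀ u v → remove E (remove E M) u v ≡ M u v
remove-remove {E = E} {M} M⊆E u v with E u v | M u v | M⊆E u v
... | true  | true  | _ = refl
... | true  | false | _ = refl
... | false | false | _ = refl
... | false | true  | h = ⊥-elim (h tt)

module _ {E M : Rel n} (M⊆E : M ⊆ᴿ E) where
  private
    M⊆kept : M ⊆ᴿ remove E (remove E M)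
    M⊆kept u v = subst T (sym (remove-remove M⊆E u v))

    kept⊆M : remove E (remove E M) ⊆ᴿ M
    kept⊆M u v = subst T (remove-remove M⊆E u v)

  matching-isMECSolution : {C : Set} (c : Fin n → C) → Symmetric E → (∀ u v → T (E u v) → c u ≢ c v) →
    Symmetric M → Functional M → IsMECSolution E c (remove E M)
  matching-isMECSolution c E-sym E-proper M-sym M-fun =
    (λ u v → proj₁ ∘ to T-∧) , (λ u v → cong₂ _∧_ (E-sym u v) (cong not (M-sym u v))) , colorful
    where
    colorful : AllColorful c (remove E (remove E M))
    colorful u v u≢v uv with reach-⊆-matching kept⊆M M-sym M-fun n uv
    ... | inj₁ u≡v = ⊥-elim (u≢v u≡v)
    ... | inj₂ Muv = E-proper u v (M⊆E u v Muv)

  matching≤closureEdges :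
    ∑[ u < n ] ∑[ v < n ] indicator (u <ᵇ v ∧ M u v) ≤ closureEdges (remove E (remove E M))
  matching≤closureEdges = begin
    ∑[ u < n ] ∑[ v < n ] indicator (u <ᵇ v ∧ M u v)
      ≤⟨ ∑∑-mono-≤ (λ u v → indicator-mono (λ t →
           let u<v , Muv = to T-∧ t in
           from T-∧ (u<v , edge⇒Connected {A = remove E (remove E M)} (M⊆kept u v Muv)))) ⟩
    ∑[ u < n ] ∑[ v < n ] indicator (u <ᵇ v ∧ reach n (remove E (remove E M)) u v)
      ≡⟨ closureEdges≡∑∑ (remove E (remove E M)) ⟨
    closureEdges (remove E (remove E M)) ∎
    where open ≤-Reasoning

module _ {E : Rel n} (E-sym : Symmetric E) (D : DFSTree E) where
  open DFSTree D

  leafChild : Rel n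
  leafChild u v = isChild v u ∧ isLeaf v

  leafMatching : Rel n
  leafMatching = symmetrize (choice leafChild)

  private
    module _ (u v : Fin n) (t : T (leafChild u v)) where
      leafChild⇒isChild : T (isChild v u)
      leafChild⇒isChild = proj₁ (to (T-∧ {isChild v u}) t)

      leafChild⇒parent : parent v ≡ u
      leafChild⇒parent = toWitness (proj₂ (to (T-∧ {not ⌊ v ≟ root ⌋}) leafChild⇒isChild))

      leafChild⇒nonroot : v ≢ root
      leafChild⇒nonroot = toWitnessFalse (proj₁ (to (T-∧ {not ⌊ v ≟ root ⌋}) leafChild⇒isChild))

      leafChild⇒leaf : T (isLeaf v)
      leafChild⇒leaf = proj₂ (to (T-∧ {isChild v u}) t)

    leafChild⊆E : leafChild ⊆ᴿ E
    leafChild⊆E u v t = subst T (E-sym v u)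
      (subst (T ∘ E v) (leafChild⇒parent u v t) (tree-edges v (leafChild⇒nonroot u v t)))

    leafChild-injective : Injective leafChild
    leafChild-injective {u} {v} {w} uw vw =
      trans (sym (leafChild⇒parent u w uw)) (leafChild⇒parent v w vw)

    leafChild-targetsAreSinks : TargetsAreSinks leafChild
    leafChild-targetsAreSinks {u} {v} {w} uv vw =
      subst T (to T-not-≡ (leafChild⇒leaf u v uv)) (anyᶠ⁺ {p = λ x → isChild x v} w (leafChild⇒isChild v w vw))

    chosen-injective : Injective (choice leafChild)
    chosen-injective {u} {v} {w} uw vw =
      leafChild-injective (choice-⊆ leafChild u w uw) (choice-⊆ leafChild v w vw)

    chosen-targetsAreSinks : TargetsAreSinks (choice leafChild)
    chosen-targetsAreSinks {u} {v} {w} uv vw =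
      leafChild-targetsAreSinks (choice-⊆ leafChild u v uv) (choice-⊆ leafChild v w vw)

  leafMatching⊆E : leafMatching ⊆ᴿ E
  leafMatching⊆E u v t with to T-∨ t
  ... | inj₁ uv = leafChild⊆E u v (choice-⊆ leafChild u v uv)
  ... | inj₂ vu = subst T (E-sym v u) (leafChild⊆E v u (choice-⊆ leafChild v u vu))

  leafMatching-symmetric : Symmetric leafMatching
  leafMatching-symmetric = symmetrize-symmetric (choice leafChild)

  leafMatching-functional : Functional leafMatching
  leafMatching-functional =
    symmetrize-functional (choice-functional leafChild) chosen-injective chosen-targetsAreSinks

  sizeVA≤leafMatching : sizeVA ≤ ∑[ u < n ] ∑[ v < n ] indicator (u <ᵇ v ∧ leafMatching u v)
  sizeVA≤leafMatching = begin
    countᶠ inVA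
      ≡⟨ countᶠ≡∑ inVA ⟩
    ∑[ u < n ] indicator (inVA u)
      ≤⟨ ∑-mono-≤ (λ u → ≤-trans (indicator-mono chosen-exists) (indicator-anyᶠ≤∑ (choice leafChild u))) ⟩
    ∑[ u < n ] ∑[ v < n ] indicator (choice leafChild u v)
      ≤⟨ ∑∑-asymmetric≤ (choice leafChild) chosen-targetsAreSinks ⟩
    ∑[ u < n ] ∑[ v < n ] indicator (u <ᵇ v ∧ leafMatching u v) ∎
    where
    open ≤-Reasoning
    chosen-exists : ∀ {u} → T (inVA u) → T (anyᶠ (choice leafChild u))
    chosen-exists {u} t =
      let v , uv = anyᶠ⁻ {p = leafChild u} t
          w , uw = choice-total leafChild uv
      in anyᶠ⁺ {p = choice leafChild u} w uw

lemma8 : (n : ℕ) (C : Set) (E : Rel n) (c : Fin n → C) →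
    (∀ u v → E u v ≡ E v u) →
    (∀ u v → T (E u v) → c u ≢ c v) →
    (k : ℕ) → 0 < k →
    (D : DFSTree E) →
    k ≤ DFSTree.sizeVA D →
    ∃ λ (E' : Rel n) → IsMECSolution E c E' × k ≤ closureEdges (remove E E')
lemma8 n C E c E-sym E-proper k _ D k≤|VA| =
  remove E M ,
  matching-isMECSolution M⊆E c E-sym E-proper
    (leafMatching-symmetric E-sym D) (leafMatching-functional E-sym D) ,
  ≤-trans k≤|VA| (≤-trans (sizeVA≤leafMatching E-sym D) (matching≤closureEdges M⊆E))
  where
  M : Rel n
  M = leafMatching E-sym D

  M⊆E : M ⊆ᴿ E
  M⊆E = leafMatching⊆E E-sym D
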